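{- Let $T$ be a finite rooted tree and suppose each node $u$ of $T$ is assigned integers $a(u), b(u)$ and the interval $I(u) = [a(u), b(u)]$. For a node $u$ let $T_u$ be the set of descendants of $u$ (including $u$), and let $\overline{a}(u) = \max_{v \in T_u} a(v)$ and $\overline{b}(u) = \max_{v \in T_u} b(v)$. Suppose that: (i) for each $u \in T$, $b(u) \ge \overline{a}(u)$; (ii) for each $u \in T$ and each child $v$ of $u$, $a(v) > a(u)$; (iii) for any two distinct siblings $u,v \in T$, the intervals $[a(u), \overline{b}(u)]$ and $[a(v), \overline{b}(v)]$ are disjoint. Then the assignment is left-including: for all $u,v \in T$, $u$ is an ancestor of $v$ if and only if $a(v) \in I(u)$.
   Context: In a rooted tree, $u$ is an ancestor of $v$ (equivalently $v$ is a descendant of $u$) if $u$ lies on the unique path from the root to $v$; every node is an ancestor and a descendant of itself. Siblings are nodes with the same parent. $[x,y]$ denotes the closed interval $\{z : x \le z \le y\}$. -}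

module Defs where

open import Data.Nat using (ℕ)
open import Data.Fin using (Fin; zero; suc)
open import Data.Integer using (ℤ; _≤_; _<_; _⊔_)
open import Data.Product using (_×_; ∃)
open import Relation.Nullary using (¬_)
open import Relation.Binary.PropositionalEquality using (_≡_)

data Tree : Set where
  node : (k : ℕ) → (Fin k → Tree) → Tree

-- Nodes of a tree, given as paths from the root.
data Node : Tree → Set where
  root  : ∀ {t} → Node t
  below : ∀ {k f} (i : Fin k) → Node (f i) → Node (node k f)

-- u ≼ v : u is an ancestor of v (reflexive: every node is its own ancestor).
data _≼_ : {t : Tree} → Node t → Node t → Set where
  root≼  : ∀ {t} {v : Node t} → root ≼ v
  below≼ : ∀ {k f} {i : Fin k} {u v : Node (f i)} → u ≼ v → below {k} {f} i u ≼ below i v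

data Child : {t : Tree} → Node t → Node t → Set where
  child-root  : ∀ {k f} (i : Fin k) → Child {node k f} root (below i root)
  child-below : ∀ {k f} {i : Fin k} {u v : Node (f i)} → Child u v → Child (below {k} {f} i u) (below i v)

Siblings : {t : Tree} → Node t → Node t → Set
Siblings {t} u v = ∃ (λ (w : Node t) → Child w u × Child w v) × ¬ (u ≡ v)

maxFin : (k : ℕ) → (Fin k → ℤ) → ℤ → ℤ
maxFin ℕ.zero    g m = m
maxFin (ℕ.suc k) g m = g zero ⊔ maxFin k (λ i → g (suc i)) m

maxTree : (t : Tree) → (Node t → ℤ) → ℤ
maxTree (node k f) g = maxFin k (λ i → maxTree (f i) (λ p → g (below i p))) (g root)

maxDesc : (t : Tree) → (Node t → ℤ) → Node t → ℤ
maxDesc t g root = maxTree t g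
maxDesc (node k f) g (below i p) = maxDesc (f i) (λ q → g (below i q)) p

_∈[_,_] : ℤ → ℤ → ℤ → Set
z ∈[ x , y ] = (x ≤ z) × (z ≤ y)

Disjoint : ℤ → ℤ → ℤ → ℤ → Set
Disjoint x₁ y₁ x₂ y₂ = ∀ z → ¬ (z ∈[ x₁ , y₁ ] × z ∈[ x₂ , y₂ ])

module Submission where

-- Write  u ≼ v  for "u is an ancestor of v" and  b̄(u) = maxDesc b u.
--   Soundness (u ≼ v ⇒ a(v) ∈ [a(u), b(u)]): a is monotone along ≼ because it
--   strictly increases from parent to child, and a(v) ≤ ā(u) ≤ b(u) because v
--   is a descendant of u.
--   Completeness (a(v) ∈ [a(u), b(u)] ⇒ u ≼ v): induction on the path to u.
--   If u is the root there is nothing to show.  Otherwise u lies in the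
--   subtree of some child c of the root; v cannot be the root (a(root) < a(u)),
--   so v lies below some child c'.  If c = c' we recurse into that subtree;
--   if c ≠ c', then a(v) lies both in [a(c), b̄(c)] and in [a(c'), b̄(c')],
--   contradicting the disjointness of sibling spans.

open import Data.Fin using (Fin; _≟_)
open import Data.Integer using (ℤ; _≤_; _<_)
open import Data.Integer.Properties
  using (≤-refl; ≤-trans; <⇒≤; <-≤-trans; <⇒≱; i≤i⊔j; i≤j⇒i≤k⊔j)
open import Data.Nat using (ℕ)
open import Data.Product using (_,_)
open import Data.Empty using (⊥-elim)
open import Function.Bundles using (_⇔_; mk⇔)
open import Relation.Nullary using (¬_; yes; no)
open import Relation.Binary.PropositionalEquality using (_≡_; refl)

open import Defs

maxFin-start : ∀ k (g : Fin k → ℤ) m → m ≤ maxFin k g m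
maxFin-start ℕ.zero    g m = ≤-refl
maxFin-start (ℕ.suc k) g m = i≤j⇒i≤k⊔j (g Fin.zero) (maxFin-start k (λ i → g (Fin.suc i)) m)

maxFin-entry : ∀ k (g : Fin k → ℤ) m (i : Fin k) → g i ≤ maxFin k g m
maxFin-entry (ℕ.suc k) g m Fin.zero    = i≤i⊔j (g Fin.zero) _
maxFin-entry (ℕ.suc k) g m (Fin.suc i) =
  i≤j⇒i≤k⊔j (g Fin.zero) (maxFin-entry k (λ j → g (Fin.suc j)) m i)

maxTree-upper : ∀ t (g : Node t → ℤ) (p : Node t) → g p ≤ maxTree t g
maxTree-upper (node k f) g root        = maxFin-start k _ (g root)
maxTree-upper (node k f) g (below i p) =
  ≤-trans (maxTree-upper (f i) (λ q → g (below i q)) p)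
          (maxFin-entry k (λ j → maxTree (f j) (λ q → g (below j q))) (g root) i)

maxDesc-upper : ∀ {t} (g : Node t → ℤ) {u v : Node t} → u ≼ v → g v ≤ maxDesc t g u
maxDesc-upper {t} g root≼ = maxTree-upper t g _
maxDesc-upper {node k f} g (below≼ {i = i} u≼v) = maxDesc-upper (λ q → g (below i q)) u≼v

≼-refl : ∀ {t} (u : Node t) → u ≼ u
≼-refl root        = root≼
≼-refl (below i u) = below≼ (≼-refl u)

Increasing : (t : Tree) → (Node t → ℤ) → Set
Increasing t a = ∀ u v → Child u v → a u < a v

Dominating : (t : Tree) → (Node t → ℤ) → (Node t → ℤ) → Set
Dominating t a b = ∀ u → maxDesc t a u ≤ b u

SiblingDisjoint : (t : Tree) → (Node t → ℤ) → (Node t → ℤ) → Set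
SiblingDisjoint t a b =
  ∀ u v → Siblings u v → Disjoint (a u) (maxDesc t b u) (a v) (maxDesc t b v)

_↾_ : ∀ {k f} {A : Set} → (Node (node k f) → A) → (i : Fin k) → Node (f i) → A
(g ↾ i) q = g (below i q)

Increasing-↾ : ∀ {k f} {a : Node (node k f) → ℤ} →
  Increasing (node k f) a → (i : Fin k) → Increasing (f i) (a ↾ i)
Increasing-↾ inc i u v c = inc _ _ (child-below c)

Dominating-↾ : ∀ {k f} {a b : Node (node k f) → ℤ} →
  Dominating (node k f) a b → (i : Fin k) → Dominating (f i) (a ↾ i) (b ↾ i)
Dominating-↾ dom i u = dom (below i u)

Siblings-below : ∀ {k f} {i : Fin k} {u v : Node (f i)} →
  Siblings u v → Siblings (below {k} {f} i u) (below i v)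
Siblings-below ((w , c₁ , c₂) , u≢v) =
  (below _ w , child-below c₁ , child-below c₂) , λ { refl → u≢v refl }

SiblingDisjoint-↾ : ∀ {k f} {a b : Node (node k f) → ℤ} →
  SiblingDisjoint (node k f) a b → (i : Fin k) → SiblingDisjoint (f i) (a ↾ i) (b ↾ i)
SiblingDisjoint-↾ disj i u v sib = disj _ _ (Siblings-below sib)

mutual
  ≼-monotone : ∀ {t} {a : Node t → ℤ} → Increasing t a →
    ∀ {u v} → u ≼ v → a u ≤ a v
  ≼-monotone inc {v = root}      root≼ = ≤-refl
  ≼-monotone inc {v = below i p} root≼ = <⇒≤ (root-below inc i p)
  ≼-monotone inc (below≼ {i = i} u≼v)  = ≼-monotone (Increasing-↾ inc i) u≼v

  root-below : ∀ {k f} {a : Node (node k f) → ℤ} → Increasing (node k f) a →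
    ∀ i p → a root < a (below i p)
  root-below inc i p =
    <-≤-trans (inc _ _ (child-root i)) (≼-monotone (Increasing-↾ inc i) root≼)

own-interval : ∀ {t} {a b : Node t → ℤ} → Dominating t a b →
  ∀ v → a v ∈[ a v , b v ]
own-interval {a = a} dom v = ≤-refl , ≤-trans (maxDesc-upper a (≼-refl v)) (dom v)

span-widening : ∀ {t} {a b : Node t → ℤ} → Increasing t a →
  ∀ {w u} x → w ≼ u → x ∈[ a u , b u ] → x ∈[ a w , maxDesc t b w ]
span-widening {b = b} inc x w≼u (au≤x , x≤bu) =
  ≤-trans (≼-monotone inc w≼u) au≤x , ≤-trans x≤bu (maxDesc-upper b w≼u)

ancestor⇒inside : ∀ {t} {a b : Node t → ℤ} → Increasing t a → Dominating t a b →
  ∀ {u v} → u ≼ v → a v ∈[ a u , b u ]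
ancestor⇒inside {a = a} inc dom {u} u≼v =
  ≼-monotone inc u≼v , ≤-trans (maxDesc-upper a u≼v) (dom u)

different-branches-outside : ∀ {k f} {a b : Node (node k f) → ℤ} →
  Increasing (node k f) a → Dominating (node k f) a b → SiblingDisjoint (node k f) a b →
  ∀ {i j} → ¬ i ≡ j → ∀ u v → ¬ a (below j v) ∈[ a (below i u) , b (below i u) ]
different-branches-outside {a = a} {b} inc dom disj {i} {j} i≢j u v inside =
  disj (below i root) (below j root) siblings (a (below j v))
    ( span-widening {b = b} inc _ (below≼ root≼) inside
    , span-widening {b = b} inc _ (below≼ root≼) (own-interval dom (below j v)) )
  where
  siblings : Siblings (below i root) (below j root)
  siblings = (root , child-root i , child-root j) , λ { refl → i≢j refl }

inside⇒ancestor : ∀ {t} {a b : Node t → ℤ} →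
  Increasing t a → Dominating t a b → SiblingDisjoint t a b →
  ∀ u v → a v ∈[ a u , b u ] → u ≼ v
inside⇒ancestor inc dom disj root v _ = root≼
inside⇒ancestor inc dom disj (below i u) root (au≤aroot , _) =
  ⊥-elim (<⇒≱ (root-below inc i u) au≤aroot)
inside⇒ancestor inc dom disj (below i u) (below j v) inside with i ≟ j
... | yes refl = below≼ (inside⇒ancestor (Increasing-↾ inc i) (Dominating-↾ dom i)
                                         (SiblingDisjoint-↾ disj i) u v inside)
... | no i≢j   = ⊥-elim (different-branches-outside inc dom disj i≢j u v inside)

lemma2 : (T : Tree) (a b : Node T → ℤ)
    → (∀ u → maxDesc T a u ≤ b u)
    → (∀ u v → Child u v → a u < a v)
    → (∀ u v → Siblings u v → Disjoint (a u) (maxDesc T b u) (a v) (maxDesc T b v))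
    → ∀ u v → (u ≼ v) ⇔ (a v ∈[ a u , b u ])
lemma2 T a b dom inc disj u v =
  mk⇔ (ancestor⇒inside inc dom) (inside⇒ancestor inc dom disj u v)
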